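{- Let $q \ge 2$, $n$, $t$ be positive integers with $t \le 10\sqrt{n}$. For every integer $k \ge 0$ with $2k+2 \le n$, \[ W_q(n,t,2k+2) \le W_q(n,t,2k+1) \le 2 \left( \frac{q^2 t}{(q-1)n} \right)^k W_q(n,t,1) \le 2 \left( \frac{q^2 t}{(q-1)n} \right)^{k+1} V_q(n,t). \]
   Context: For $x,y \in [q]^n$, $d(x,y)$ is the Hamming distance and $B_q(x,r) = \{ y \in [q]^n : d(x,y) \le r\}$. $V_q(n,r) = \sum_{j=0}^{r}\binom{n}{j}(q-1)^j = |B_q(x,r)|$. For $0 \le k \le n$, $W_q(n,t,k)$ denotes $|B_q(x,t) \cap B_q(y,t)|$ for any $x,y \in [q]^n$ with $d(x,y) = k$ (independent of the choice). -}

module Defs where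

open import Data.Nat using (ℕ; zero; suc; _+_; _*_; _∸_; _^_; _≤ᵇ_; _<ᵇ_)
open import Data.Nat.Combinatorics using (_C_)
open import Data.Fin using (Fin; toℕ)
import Data.Fin
open import Data.Fin.Properties using () renaming (_≟_ to _≟ᶠ_)
open import Data.Vec using (Vec; []; _∷_; tabulate)
open import Data.List using (List; []; _∷_; concatMap; map; filterᵇ; length)
open import Data.Bool using (Bool; true; false; if_then_else_; _∧_)
open import Relation.Nullary.Decidable using (does)

Word : ℕ → ℕ → Set
Word q n = Vec (Fin q) n

allFin : (q : ℕ) → List (Fin q)
allFin zero = []
allFin (suc q) = Data.Fin.zero ∷ map Data.Fin.suc (allFin q)


allWords : (q n : ℕ) → List (Word q n)
allWords q zero = [] ∷ []
allWords q (suc n) = concatMap (λ a → map (a ∷_) (allWords q n)) (allFin q)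

dist : ∀ {q n} → Word q n → Word q n → ℕ
dist [] [] = 0
dist (a ∷ x) (b ∷ y) = (if does (a ≟ᶠ b) then 0 else 1) + dist x y

ballIntersectionSize : ∀ {q n} → ℕ → Word q n → Word q n → ℕ
ballIntersectionSize {q} {n} t x y =
  length (filterᵇ (λ z → (dist x z ≤ᵇ t) ∧ (dist y z ≤ᵇ t)) (allWords q n))

zeroWord : ∀ q' n → Word (suc (suc q')) n
zeroWord q' n = tabulate (λ _ → Data.Fin.zero)

onesWord : ∀ q' n → ℕ → Word (suc (suc q')) n
onesWord q' n k = tabulate (λ i → if toℕ i <ᵇ k then Data.Fin.suc Data.Fin.zero else Data.Fin.zero)

-- W_q(n,t,k) for q = 2 + q', computed at the canonical pair (x,y) with d(x,y) = k
W : (q' n t k : ℕ) → ℕ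
W q' n t k = ballIntersectionSize t (zeroWord q' n) (onesWord q' n k)

V : (q n r : ℕ) → ℕ
V q n zero = n C 0
V q n (suc r) = V q n r + (n C suc r) * (q ∸ 1) ^ suc r

-- For words x, y differing in j coordinates and agreeing in m, reading off the first coordinate of a
-- word gives a recursion for |B(x, t − s₁) ∩ B(y, t − s₂)|, and every inequality below is an induction
-- along it. The key one is double counting: with n = j + m + 1 coordinates, (q − 1)n times the
-- intersection of the radius-(t − 1) balls is at most t times the intersection of the radius-t balls.
-- Peeling two disagreeing coordinates costs at most a factor q², since each of the nine branches lands
-- in the intersection of the radius-(t − 1) balls; so two steps in the distance cost at most the factor
-- q²t / ((q − 1)n). At distance 1, W(n, t, 1) is at most q times a ball of radius t − 1 in n − 1
-- coordinates, and the same double counting compares that ball with V(n, t).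
{-# OPTIONS --safe #-}
module Submission where

open import Defs
open import Data.Nat using (ℕ; suc; _+_; _*_; _∸_; _^_; _≤_)
open import Data.Product using (_×_)

open import Data.Nat using (zero; _<_; _≤ᵇ_; _≤?_; z≤n; s≤s)
open import Data.Nat.Properties
open import Data.Nat.Tactic.RingSolver using (solve-∀)
open import Data.Nat.Combinatorics using (_C_; nCk+nC[k+1]≡[n+1]C[k+1])
open import Data.Nat.ListAction using (sum)
open import Data.Product using (_,_)
open import Data.Sum using (inj₁; inj₂)
open import Data.Bool using (Bool; true; false; if_then_else_; _∧_)
open import Data.List using (List; []; _∷_; map; length; filterᵇ; concatMap; _++_)
open import Data.List.Properties using (map-∘)
open import Data.Vec using (_∷_)
open import Data.Fin using (Fin) renaming (zero to fzero; suc to fsuc)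
open import Data.Fin.Properties using () renaming (_≟_ to _≟ᶠ_)
open import Function using (_∘_)
open import Relation.Binary.PropositionalEquality
open import Relation.Nullary using (yes; no; contradiction)
open import Relation.Nullary.Decidable using (does)
open import Relation.Nullary.Reflects using (ofʸ; ofⁿ)

open ≤-Reasoning

private variable A B : Set

count : (A → Bool) → List A → ℕ
count p xs = length (filterᵇ p xs)

count-++ : ∀ (p : A → Bool) xs ys → count p (xs ++ ys) ≡ count p xs + count p ys
count-++ p [] ys = refl
count-++ p (x ∷ xs) ys with p x
... | true  = cong suc (count-++ p xs ys)
... | false = count-++ p xs ys

count-cong : ∀ {p p′ : A → Bool} → (∀ z → p z ≡ p′ z) → ∀ xs → count p xs ≡ count p′ xs
count-cong p≗p′ [] = refl
count-cong {p = p} {p′} p≗p′ (x ∷ xs) with p x | p′ x | p≗p′ x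
... | true  | .true  | refl = cong suc (count-cong p≗p′ xs)
... | false | .false | refl = count-cong p≗p′ xs

count-map : ∀ (p : B → Bool) (f : A → B) xs → count p (map f xs) ≡ count (p ∘ f) xs
count-map p f [] = refl
count-map p f (x ∷ xs) with p (f x)
... | true  = cong suc (count-map p f xs)
... | false = count-map p f xs

count-concatMap : ∀ (p : B → Bool) (f : A → List B) xs → count p (concatMap f xs) ≡ sum (map (count p ∘ f) xs)
count-concatMap p f [] = refl
count-concatMap p f (x ∷ xs) =
  trans (count-++ p (f x) (concatMap f xs)) (cong (count p (f x) +_) (count-concatMap p f xs))

sum-map-cong : ∀ {f g : A → ℕ} → (∀ a → f a ≡ g a) → ∀ xs → sum (map f xs) ≡ sum (map g xs)
sum-map-cong f≗g [] = refl
sum-map-cong f≗g (x ∷ xs) = cong₂ _+_ (f≗g x) (sum-map-cong f≗g xs)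

sum-map-map : ∀ {f : B → ℕ} {g : A → B} xs → sum (map f (map g xs)) ≡ sum (map (f ∘ g) xs)
sum-map-map xs = cong sum (sym (map-∘ xs))

sum-map-allFin-const : ∀ k (f : Fin k → ℕ) {c} → (∀ i → f i ≡ c) → sum (map f (allFin k)) ≡ k * c
sum-map-allFin-const zero f f≡c = refl
sum-map-allFin-const (suc k) f f≡c = cong₂ _+_ (f≡c fzero)
  (trans (sum-map-map (allFin k)) (sum-map-allFin-const k (f ∘ fsuc) (f≡c ∘ fsuc)))

V-zero-length : ∀ q r → V q 0 r ≡ 1
V-zero-length q zero = refl
V-zero-length q (suc r) rewrite V-zero-length q r = refl

V-pascal : ∀ q m r → V q (suc m) (suc r) ≡ V q m (suc r) + (q ∸ 1) * V q m r
V-pascal q m zero rewrite sym (nCk+nC[k+1]≡[n+1]C[k+1] m 0) = shape (q ∸ 1) (m C 1)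
  where
  shape : ∀ a c → 1 + (1 + c) * (a * 1) ≡ (1 + c * (a * 1)) + a * 1
  shape = solve-∀
V-pascal q m (suc r) rewrite V-pascal q m r | sym (nCk+nC[k+1]≡[n+1]C[k+1] m (suc r)) =
  shape (q ∸ 1) (V q m (suc r)) (V q m r) (m C suc r) (m C suc (suc r)) ((q ∸ 1) ^ suc r)
  where
  shape : ∀ a X Y c₁ c₂ P → (X + a * Y) + (c₁ + c₂) * (a * P) ≡ (X + c₂ * (a * P)) + a * (Y + c₁ * P)
  shape = solve-∀

rearrangement-≤ : ∀ {a a′ b b′} → a′ ≤ a → b′ ≤ b → a * b′ + a′ * b ≤ a * b + a′ * b′
rearrangement-≤ {a′ = a′} {b′ = b′} a′≤a b′≤b
  with d , refl ← m≤n⇒∃[o]m+o≡n a′≤a | e , refl ← m≤n⇒∃[o]m+o≡n b′≤b =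
  subst ((a′ + d) * b′ + a′ * (b′ + e) ≤_) (shape a′ d b′ e) (m≤m+n _ (d * e))
  where
  shape : ∀ a′ d b′ e → (a′ + d) * b′ + a′ * (b′ + e) + d * e ≡ (a′ + d) * (b′ + e) + a′ * b′
  shape = solve-∀

iterate-≤ : ∀ (w : ℕ → ℕ) a r k → (∀ i → i < k → w (suc i) * r ≤ a * w i) → w k * r ^ k ≤ a ^ k * w 0
iterate-≤ w a r zero step = ≤-reflexive (trans (*-identityʳ (w 0)) (sym (+-identityʳ (w 0))))
iterate-≤ w a r (suc k) step = begin
  w (suc k) * (r * r ^ k)   ≡⟨ *-assoc (w (suc k)) r (r ^ k) ⟨
  w (suc k) * r * r ^ k     ≤⟨ *-monoˡ-≤ (r ^ k) (step k (n<1+n k)) ⟩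
  a * w k * r ^ k           ≡⟨ *-assoc a (w k) (r ^ k) ⟩
  a * (w k * r ^ k)         ≤⟨ *-monoʳ-≤ a (iterate-≤ w a r k (λ i i<k → step i (m<n⇒m<1+n i<k))) ⟩
  a * (a ^ k * w 0)         ≡⟨ *-assoc a (a ^ k) (w 0) ⟨
  a * a ^ k * w 0           ∎

cross-mul-pow-≤ : ∀ {x y} a r c k → x * r ≤ a * y →
  c * a ^ k * x * r ^ (k + 1) ≤ c * a ^ (k + 1) * y * r ^ k
cross-mul-pow-≤ {x} {y} a r c k xr≤ay rewrite +-comm k 1 = begin
  c * a ^ k * x * (r * r ^ k)   ≡⟨ shapeˡ c (a ^ k) x r (r ^ k) ⟩
  c * a ^ k * r ^ k * (x * r)   ≤⟨ *-monoʳ-≤ (c * a ^ k * r ^ k) xr≤ay ⟩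
  c * a ^ k * r ^ k * (a * y)   ≡⟨ shapeʳ c (a ^ k) (r ^ k) a y ⟩
  c * (a * a ^ k) * y * r ^ k   ∎
  where
  shapeˡ : ∀ c a x r s → c * a * x * (r * s) ≡ c * a * s * (x * r)
  shapeˡ = solve-∀
  shapeʳ : ∀ c a s b y → c * a * s * (b * y) ≡ c * (b * a) * y * s
  shapeʳ = solve-∀

module _ (q′ t : ℕ) where

  q p : ℕ
  q = 2 + q′
  p = 1 + q′

  within : ℕ → ℕ
  within s = if s ≤ᵇ t then 1 else 0

  within-≡1 : ∀ {s} → s ≤ t → within s ≡ 1
  within-≡1 {s} s≤t with s ≤ᵇ t | ≤ᵇ-reflects-≤ s t
  ... | true  | _        = refl
  ... | false | ofⁿ s≰t = contradiction s≤t s≰t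

  within-≡0 : ∀ {s} → t < s → within s ≡ 0
  within-≡0 {s} t<s with s ≤ᵇ t | ≤ᵇ-reflects-≤ s t
  ... | true  | ofʸ s≤t = contradiction s≤t (<⇒≱ t<s)
  ... | false | _        = refl

  within-≤1 : ∀ s → within s ≤ 1
  within-≤1 s with s ≤ᵇ t
  ... | true  = ≤-refl
  ... | false = z≤n

  within-antitone : ∀ s → within (suc s) ≤ within s
  within-antitone s with s ≤ᵇ t | ≤ᵇ-reflects-≤ s t
  ... | true  | _        = within-≤1 (suc s)
  ... | false | ofⁿ s≰t = ≤-reflexive (within-≡0 (m<n⇒m<1+n (≰⇒> s≰t)))

  -- A coordinate where x and y differ: z agrees with x, with y, or (in q − 2 ways) with neither.
  disagreeing : ℕ → ℕ → ℕ → ℕ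
  disagreeing a b c = a + b + q′ * c

  -- A coordinate where x and y agree: z agrees with both, or (in q − 1 ways) with neither.
  agreeing : ℕ → ℕ → ℕ
  agreeing a b = a + p * b

  disagreeing-mono-≤ : ∀ {a a′ b b′ c c′} → a ≤ a′ → b ≤ b′ → c ≤ c′ →
    disagreeing a b c ≤ disagreeing a′ b′ c′
  disagreeing-mono-≤ a≤ b≤ c≤ = +-mono-≤ (+-mono-≤ a≤ b≤) (*-monoʳ-≤ q′ c≤)

  agreeing-mono-≤ : ∀ {a a′ b b′} → a ≤ a′ → b ≤ b′ → agreeing a b ≤ agreeing a′ b′
  agreeing-mono-≤ a≤ b≤ = +-mono-≤ a≤ (*-monoʳ-≤ p b≤)

  agreeing-+ : ∀ a b c d → agreeing a b + agreeing c d ≡ agreeing (a + c) (b + d)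
  agreeing-+ = shape q′
    where
    shape : ∀ k a b c d → a + suc k * b + (c + suc k * d) ≡ a + c + suc k * (b + d)
    shape = solve-∀

  disagreeing-agreeing : ∀ a a′ b b′ c c′ →
    disagreeing (agreeing a a′) (agreeing b b′) (agreeing c c′)
      ≡ agreeing (disagreeing a b c) (disagreeing a′ b′ c′)
  disagreeing-agreeing = shape q′
    where
    shape : ∀ k a a′ b b′ c c′ → (a + suc k * a′) + (b + suc k * b′) + k * (c + suc k * c′)
      ≡ (a + b + k * c) + suc k * (a′ + b′ + k * c′)
    shape = solve-∀

  disagreeing-diag : ∀ x → disagreeing x x x ≡ q * x
  disagreeing-diag = shape q′
    where
    shape : ∀ k x → x + x + k * x ≡ suc (suc k) * x
    shape = solve-∀

  -- cap s₁ s₂ j m = |{z ∈ [q]^(j+m) : s₁ + d(x,z) ≤ t and s₂ + d(y,z) ≤ t}| where x and y differ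
  -- exactly in their first j coordinates; the budgets s₁, s₂ avoid truncated subtraction t ∸ s.
  cap : ℕ → ℕ → ℕ → ℕ → ℕ
  cap s₁ s₂ (suc j) m = disagreeing (cap s₁ (suc s₂) j m) (cap (suc s₁) s₂ j m) (cap (suc s₁) (suc s₂) j m)
  cap s₁ s₂ zero (suc m) = agreeing (cap s₁ s₂ zero m) (cap (suc s₁) (suc s₂) zero m)
  cap s₁ s₂ zero zero = within s₁ * within s₂

  cap-zeroˡ : ∀ j m {s₁} s₂ → t < s₁ → cap s₁ s₂ j m ≡ 0
  cap-zeroˡ (suc j) m s₂ t<s₁
    rewrite cap-zeroˡ j m (suc s₂) t<s₁ | cap-zeroˡ j m s₂ (m<n⇒m<1+n t<s₁)
          | cap-zeroˡ j m (suc s₂) (m<n⇒m<1+n t<s₁) = *-zeroʳ q′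
  cap-zeroˡ zero (suc m) s₂ t<s₁
    rewrite cap-zeroˡ zero m s₂ t<s₁ | cap-zeroˡ zero m (suc s₂) (m<n⇒m<1+n t<s₁) = *-zeroʳ p
  cap-zeroˡ zero zero s₂ t<s₁ rewrite within-≡0 t<s₁ = refl

  cap-comm : ∀ j m s₁ s₂ → cap s₁ s₂ j m ≡ cap s₂ s₁ j m
  cap-comm (suc j) m s₁ s₂
    rewrite cap-comm j m s₁ (suc s₂) | cap-comm j m (suc s₁) s₂ | cap-comm j m (suc s₁) (suc s₂) =
    cong (_+ q′ * cap (suc s₂) (suc s₁) j m) (+-comm (cap (suc s₂) s₁ j m) (cap s₂ (suc s₁) j m))
  cap-comm zero (suc m) s₁ s₂ rewrite cap-comm zero m s₁ s₂ | cap-comm zero m (suc s₁) (suc s₂) = refl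
  cap-comm zero zero s₁ s₂ = *-comm (within s₁) (within s₂)

  cap-antitoneˡ : ∀ j m s₁ s₂ → cap (suc s₁) s₂ j m ≤ cap s₁ s₂ j m
  cap-antitoneˡ (suc j) m s₁ s₂ = disagreeing-mono-≤
    (cap-antitoneˡ j m s₁ (suc s₂)) (cap-antitoneˡ j m (suc s₁) s₂) (cap-antitoneˡ j m (suc s₁) (suc s₂))
  cap-antitoneˡ zero (suc m) s₁ s₂ = agreeing-mono-≤ (cap-antitoneˡ zero m s₁ s₂) (cap-antitoneˡ zero m (suc s₁) (suc s₂))
  cap-antitoneˡ zero zero s₁ s₂ = *-monoˡ-≤ (within s₂) (within-antitone s₁)

  cap-antitoneʳ : ∀ j m s₁ s₂ → cap s₁ (suc s₂) j m ≤ cap s₁ s₂ j m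
  cap-antitoneʳ j m s₁ s₂ = subst₂ _≤_ (cap-comm j m (suc s₂) s₁) (cap-comm j m s₂ s₁) (cap-antitoneˡ j m s₂ s₁)

  -- The agreeing coordinates may be read off first as well as last.
  cap-suc-agreeing : ∀ j m s₁ s₂ → cap s₁ s₂ j (suc m) ≡ agreeing (cap s₁ s₂ j m) (cap (suc s₁) (suc s₂) j m)
  cap-suc-agreeing zero m s₁ s₂ = refl
  cap-suc-agreeing (suc j) m s₁ s₂
    rewrite cap-suc-agreeing j m s₁ (suc s₂) | cap-suc-agreeing j m (suc s₁) s₂
          | cap-suc-agreeing j m (suc s₁) (suc s₂) =
    disagreeing-agreeing (cap s₁ (suc s₂) j m) (cap (suc s₁) (suc (suc s₂)) j m)
      (cap (suc s₁) s₂ j m) (cap (suc (suc s₁)) (suc s₂) j m)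
      (cap (suc s₁) (suc s₂) j m) (cap (suc (suc s₁)) (suc (suc s₂)) j m)

  cap₀-submodular : ∀ m s₁ s₂ →
    cap s₁ (suc s₂) zero m + cap (suc s₁) s₂ zero m ≤ cap s₁ s₂ zero m + cap (suc s₁) (suc s₂) zero m
  cap₀-submodular zero s₁ s₂ = rearrangement-≤ (within-antitone s₁) (within-antitone s₂)
  cap₀-submodular (suc m) s₁ s₂ = begin
    agreeing (c 0 1) (c 1 2) + agreeing (c 1 0) (c 2 1)   ≡⟨ agreeing-+ (c 0 1) (c 1 2) (c 1 0) (c 2 1) ⟩
    agreeing (c 0 1 + c 1 0) (c 1 2 + c 2 1)
      ≤⟨ agreeing-mono-≤ (cap₀-submodular m s₁ s₂) (cap₀-submodular m (suc s₁) (suc s₂)) ⟩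
    agreeing (c 0 0 + c 1 1) (c 1 1 + c 2 2)               ≡⟨ agreeing-+ (c 0 0) (c 1 1) (c 1 1) (c 2 2) ⟨
    agreeing (c 0 0) (c 1 1) + agreeing (c 1 1) (c 2 2)   ∎
    where
    c : ℕ → ℕ → ℕ
    c a b = cap (a + s₁) (b + s₂) zero m

  cap-disagreeing≤agreeing : ∀ j m s₁ s₂ → cap s₁ s₂ (suc j) m ≤ cap s₁ s₂ j (suc m)
  cap-disagreeing≤agreeing (suc j) m s₁ s₂ = disagreeing-mono-≤
    (cap-disagreeing≤agreeing j m s₁ (suc s₂)) (cap-disagreeing≤agreeing j m (suc s₁) s₂)
    (cap-disagreeing≤agreeing j m (suc s₁) (suc s₂))
  cap-disagreeing≤agreeing zero m s₁ s₂ = begin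
    cap s₁ (suc s₂) zero m + cap (suc s₁) s₂ zero m + q′ * c₁₁
      ≤⟨ +-monoˡ-≤ (q′ * c₁₁) (cap₀-submodular m s₁ s₂) ⟩
    cap s₁ s₂ zero m + c₁₁ + q′ * c₁₁                   ≡⟨ +-assoc (cap s₁ s₂ zero m) c₁₁ (q′ * c₁₁) ⟩
    agreeing (cap s₁ s₂ zero m) c₁₁                     ∎
    where
    c₁₁ = cap (suc s₁) (suc s₂) zero m

  cap-balance : ∀ j m s₁ s₂ → s₁ ≤ suc s₂ → cap s₁ (2 + s₂) j m ≤ cap (suc s₁) (suc s₂) j m
  cap-balance (suc j) m s₁ s₂ s₁≤ =
    +-mono-≤ outer (*-monoʳ-≤ q′ (cap-balance j m (suc s₁) (suc s₂) (s≤s s₁≤)))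
    where
    far : cap s₁ (3 + s₂) j m ≤ cap (2 + s₁) (suc s₂) j m
    far with m≤n⇒m<n∨m≡n s₁≤
    ... | inj₁ s₁<  = ≤-trans (cap-balance j m s₁ (suc s₂) (m≤n⇒m≤1+n s₁≤)) (cap-balance j m (suc s₁) s₂ s₁<)
    ... | inj₂ refl = ≤-reflexive (cap-comm j m s₁ (3 + s₂))
    outer : cap s₁ (3 + s₂) j m + cap (suc s₁) (2 + s₂) j m ≤ cap (suc s₁) (2 + s₂) j m + cap (2 + s₁) (suc s₂) j m
    outer = subst (cap s₁ (3 + s₂) j m + cap (suc s₁) (2 + s₂) j m ≤_)
      (+-comm (cap (2 + s₁) (suc s₂) j m) _) (+-monoˡ-≤ (cap (suc s₁) (2 + s₂) j m) far)
  cap-balance zero (suc m) s₁ s₂ s₁≤ =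
    agreeing-mono-≤ (cap-balance zero m s₁ s₂ s₁≤) (cap-balance zero m (suc s₁) (suc s₂) (s≤s s₁≤))
  cap-balance zero zero s₁ s₂ s₁≤ with 2 + s₂ ≤? t
  ... | yes 2+s₂≤t rewrite within-≡1 2+s₂≤t | within-≡1 (≤-trans (n≤1+n _) 2+s₂≤t)
                         | within-≡1 (≤-trans (s≤s s₁≤) 2+s₂≤t) | *-identityʳ (within s₁) = within-≤1 s₁
  ... | no 2+s₂≰t rewrite within-≡0 (≰⇒> 2+s₂≰t) | *-zeroʳ (within s₁) = z≤n

  cap₀-raiseˡ : ∀ m s₁ s₂ → s₁ < s₂ → cap s₁ s₂ zero m ≤ cap (suc s₁) s₂ zero m
  cap₀-raiseˡ (suc m) s₁ s₂ s₁<s₂ =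
    agreeing-mono-≤ (cap₀-raiseˡ m s₁ s₂ s₁<s₂) (cap₀-raiseˡ m (suc s₁) (suc s₂) (s≤s s₁<s₂))
  cap₀-raiseˡ zero s₁ s₂ s₁<s₂ with s₂ ≤? t
  ... | yes s₂≤t rewrite within-≡1 s₂≤t | within-≡1 (≤-trans s₁<s₂ s₂≤t) | *-identityʳ (within s₁) = within-≤1 s₁
  ... | no s₂≰t rewrite within-≡0 (≰⇒> s₂≰t) | *-zeroʳ (within s₁) = z≤n

  shrink-agreeing-step : ∀ N c a b X → p * suc N * a ≤ suc c * X → p * suc N * b ≤ c * agreeing a b →
    p * suc (suc N) * agreeing a b ≤ suc c * agreeing X (agreeing a b)
  shrink-agreeing-step N c a b X ha hb = begin
    p * suc (suc N) * agreeing a b                            ≡⟨ shapeˡ q′ N a b ⟩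
    p * suc N * a + p * (p * suc N * b) + p * agreeing a b
      ≤⟨ +-monoˡ-≤ (p * agreeing a b) (+-mono-≤ ha (*-monoʳ-≤ p hb)) ⟩
    suc c * X + p * (c * agreeing a b) + p * agreeing a b     ≡⟨ shapeʳ q′ c X a b ⟩
    suc c * agreeing X (agreeing a b)                         ∎
    where
    shapeˡ : ∀ k N a b → suc k * suc (suc N) * (a + suc k * b)
      ≡ suc k * suc N * a + suc k * (suc k * suc N * b) + suc k * (a + suc k * b)
    shapeˡ = solve-∀
    shapeʳ : ∀ k c X a b → suc c * X + suc k * (c * (a + suc k * b)) + suc k * (a + suc k * b)
      ≡ suc c * (X + suc k * (a + suc k * b))
    shapeʳ = solve-∀

  shrink-disagreeing-step : ∀ N c a b d A B₀ D₀ →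
    p * N * a ≤ suc c * A → p * N * b ≤ c * agreeing B₀ b → p * N * d ≤ c * agreeing D₀ d →
    p * a ≤ B₀ + q′ * D₀ →
    p * suc N * disagreeing a b d ≤ suc c * disagreeing A (agreeing B₀ b) (agreeing D₀ d)
  shrink-disagreeing-step N c a b d A B₀ D₀ ha hb hd hpa = begin
    p * suc N * disagreeing a b d                                     ≡⟨ shapeˡ q′ N a b d ⟩
    disagreeing (p * N * a) (p * N * b) (p * N * d) + disagreeing (p * a) (p * b) (p * d)
      ≤⟨ +-mono-≤ (disagreeing-mono-≤ ha hb hd) (+-monoˡ-≤ (q′ * (p * d)) (+-monoˡ-≤ (p * b) hpa)) ⟩
    disagreeing (suc c * A) (c * agreeing B₀ b) (c * agreeing D₀ d)
      + disagreeing (B₀ + q′ * D₀) (p * b) (p * d)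
      ≡⟨ shapeʳ q′ c b d A B₀ D₀ ⟩
    suc c * disagreeing A (agreeing B₀ b) (agreeing D₀ d)            ∎
    where
    shapeˡ : ∀ k N a b d → suc k * suc N * (a + b + k * d)
      ≡ (suc k * N * a + suc k * N * b + k * (suc k * N * d)) + (suc k * a + suc k * b + k * (suc k * d))
    shapeˡ = solve-∀
    shapeʳ : ∀ k c b d A B₀ D₀ →
      (suc c * A + c * (B₀ + suc k * b) + k * (c * (D₀ + suc k * d)))
        + ((B₀ + k * D₀) + suc k * b + k * (suc k * d))
        ≡ suc c * (A + (B₀ + suc k * b) + k * (D₀ + suc k * d))
    shapeʳ = solve-∀

  -- The double-counting inequality, with c an upper bound for the radius t − s₁.
  cap-shrink : ∀ j m c s₁ s₂ → t ≤ c + s₁ →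
    p * suc (j + m) * cap (suc s₁) (suc s₂) j m ≤ c * cap s₁ s₂ j (suc m)
  cap-shrink j m zero s₁ s₂ t≤s₁
    rewrite cap-zeroˡ j m (suc s₂) (s≤s t≤s₁) | *-zeroʳ (p * suc (j + m)) = z≤n
  cap-shrink zero zero (suc c) s₁ s₂ _ = begin
    p * 1 * y            ≡⟨ cong (_* y) (*-identityʳ p) ⟩
    p * y                ≤⟨ m≤n+m (p * y) x ⟩
    agreeing x y         ≤⟨ m≤m+n (agreeing x y) (c * agreeing x y) ⟩
    suc c * agreeing x y ∎
    where
    x = cap s₁ s₂ zero zero
    y = cap (suc s₁) (suc s₂) zero zero
  cap-shrink zero (suc m) (suc c) s₁ s₂ t≤ =
    shrink-agreeing-step m c (cap (suc s₁) (suc s₂) zero m) (cap (2 + s₁) (2 + s₂) zero m) (cap s₁ s₂ zero (suc m))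
      (cap-shrink zero m (suc c) s₁ s₂ t≤)
      (cap-shrink zero m c (suc s₁) (suc s₂) (subst (t ≤_) (sym (+-suc c s₁)) t≤))
  cap-shrink (suc j) m (suc c) s₁ s₂ t≤
    rewrite cap-suc-agreeing j m (suc s₁) s₂ | cap-suc-agreeing j m (suc s₁) (suc s₂) =
    shrink-disagreeing-step (suc (j + m)) c a b d (cap s₁ (suc s₂) j (suc m)) B₀ D₀
      (cap-shrink j m (suc c) s₁ (suc s₂) t≤) (shrunk s₂) (shrunk (suc s₂))
      (+-mono-≤ (≤-trans a≤D₀ (cap-antitoneʳ j m (suc s₁) s₂)) (*-monoʳ-≤ q′ a≤D₀))
    where
    a = cap (suc s₁) (2 + s₂) j m
    b = cap (2 + s₁) (suc s₂) j m
    d = cap (2 + s₁) (2 + s₂) j m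
    B₀ = cap (suc s₁) s₂ j m
    D₀ = cap (suc s₁) (suc s₂) j m
    a≤D₀ : a ≤ D₀
    a≤D₀ = cap-antitoneʳ j m (suc s₁) (suc s₂)
    shrunk : ∀ s → p * suc (j + m) * cap (2 + s₁) (suc s) j m
                     ≤ c * agreeing (cap (suc s₁) s j m) (cap (2 + s₁) (suc s) j m)
    shrunk s = subst (λ z → p * suc (j + m) * cap (2 + s₁) (suc s) j m ≤ c * z)
      (cap-suc-agreeing j m (suc s₁) s)
      (cap-shrink j m c (suc s₁) s (subst (t ≤_) (sym (+-suc c s₁)) t≤))

  cap-two-disagreeing≤ : ∀ j m → cap 0 0 (2 + j) m ≤ q * q * cap 1 1 j m
  cap-two-disagreeing≤ j m = begin
    cap 0 0 (2 + j) m
      ≤⟨ disagreeing-mono-≤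
           (disagreeing-mono-≤ (cap-balance j m 0 0 z≤n) ≤-refl (cap-antitoneʳ j m 1 1))
           (disagreeing-mono-≤ ≤-refl (subst (_≤ x) (cap-comm j m 0 2) (cap-balance j m 0 0 z≤n))
             (cap-antitoneˡ j m 1 1))
           (disagreeing-mono-≤ (cap-antitoneʳ j m 1 1) (cap-antitoneˡ j m 1 1)
             (≤-trans (cap-antitoneˡ j m 1 2) (cap-antitoneʳ j m 1 1))) ⟩
    disagreeing (disagreeing x x x) (disagreeing x x x) (disagreeing x x x)
      ≡⟨ trans (cong (λ y → disagreeing y y y) (disagreeing-diag x)) (disagreeing-diag (q * x)) ⟩
    q * (q * x)                                                          ≡⟨ *-assoc q q x ⟨
    q * q * x                                                            ∎
    where
    x = cap 1 1 j m

  cap₁₁-shrink : ∀ j m → 1 ≤ t → p * (2 + j + m) * cap 1 1 j m ≤ t * cap 0 0 j (2 + m)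
  cap₁₁-shrink j m 1≤t = begin
    p * (2 + j + m) * y                            ≡⟨ shape p (j + m) y ⟩
    p * suc (j + m) * y + 1 * (p * y)
      ≤⟨ +-mono-≤ (cap-shrink j m t 0 0 (m≤m+n t 0)) (*-mono-≤ 1≤t (*-monoʳ-≤ p y≤)) ⟩
    t * cap 0 0 j (suc m) + t * (p * cap 1 1 j (suc m))   ≡⟨ *-distribˡ-+ t _ _ ⟨
    t * agreeing (cap 0 0 j (suc m)) (cap 1 1 j (suc m))  ≡⟨ cong (t *_) (cap-suc-agreeing j (suc m) 0 0) ⟨
    t * cap 0 0 j (2 + m)                                 ∎
    where
    y = cap 1 1 j m
    y≤ : y ≤ cap 1 1 j (suc m)
    y≤ = subst (y ≤_) (sym (cap-suc-agreeing j m 1 1)) (m≤m+n y _)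
    shape : ∀ p N y → p * (2 + N) * y ≡ p * suc N * y + 1 * (p * y)
    shape = solve-∀

  cap-ball : ∀ m r s → s + r ≡ t → cap s s zero m ≡ V q m r
  cap-ball zero r s s+r≡t rewrite V-zero-length q r | within-≡1 (subst (s ≤_) s+r≡t (m≤m+n s r)) = refl
  cap-ball (suc m) zero s s+0≡t
    rewrite cap-zeroˡ zero m (suc s) (≤-reflexive (cong suc (trans (sym s+0≡t) (+-identityʳ s))))
          | *-zeroʳ p | +-identityʳ (cap s s zero m) = cap-ball m zero s s+0≡t
  cap-ball (suc m) (suc r) s s+r≡t
    rewrite cap-ball m (suc r) s s+r≡t | cap-ball m r (suc s) (trans (sym (+-suc s r)) s+r≡t) = sym (V-pascal q m r)

  capCount : ∀ {n} → ℕ → ℕ → Word q n → Word q n → ℕ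
  capCount {n} s₁ s₂ x y = count (λ z → (s₁ + dist x z ≤ᵇ t) ∧ (s₂ + dist y z ≤ᵇ t)) (allWords q n)

  mismatch : ∀ {k} → Fin k → Fin k → ℕ
  mismatch a c = if does (a ≟ᶠ c) then 0 else 1

  capCount-∷ : ∀ {n} s₁ s₂ a b (x y : Word q n) →
    capCount s₁ s₂ (a ∷ x) (b ∷ y)
      ≡ sum (map (λ c → capCount (mismatch a c + s₁) (mismatch b c + s₂) x y) (allFin q))
  capCount-∷ {n} s₁ s₂ a b x y =
    trans (count-concatMap _ (λ c → map (c ∷_) (allWords q n)) (allFin q))
      (sum-map-cong (λ c → trans (count-map _ (c ∷_) (allWords q n))
          (count-cong (λ z → cong₂ _∧_ (cong (_≤ᵇ t) (regroup s₁ (mismatch a c) (dist x z)))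
                                       (cong (_≤ᵇ t) (regroup s₂ (mismatch b c) (dist y z))))
                      (allWords q n)))
        (allFin q))
    where
    regroup : ∀ s e d → s + (e + d) ≡ e + s + d
    regroup = solve-∀

  capCount-agreeing : ∀ {n} s₁ s₂ (x y : Word q n) →
    capCount s₁ s₂ (fzero ∷ x) (fzero ∷ y)
      ≡ agreeing (capCount s₁ s₂ x y) (capCount (suc s₁) (suc s₂) x y)
  capCount-agreeing s₁ s₂ x y = begin-equality
    capCount s₁ s₂ (fzero ∷ x) (fzero ∷ y)     ≡⟨ capCount-∷ s₁ s₂ _ _ x y ⟩
    capCount s₁ s₂ x y + sum (map f (map fsuc (allFin p)))
      ≡⟨ cong (capCount s₁ s₂ x y +_) (trans (sum-map-map (allFin p)) (sum-map-allFin-const p _ (λ _ → refl))) ⟩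
    agreeing (capCount s₁ s₂ x y) (capCount (suc s₁) (suc s₂) x y) ∎
    where
    f : Fin q → ℕ
    f c = capCount (mismatch fzero c + s₁) (mismatch fzero c + s₂) x y

  capCount-disagreeing : ∀ {n} s₁ s₂ (x y : Word q n) →
    capCount s₁ s₂ (fzero ∷ x) (fsuc fzero ∷ y)
      ≡ disagreeing (capCount s₁ (suc s₂) x y) (capCount (suc s₁) s₂ x y) (capCount (suc s₁) (suc s₂) x y)
  capCount-disagreeing s₁ s₂ x y = begin-equality
    capCount s₁ s₂ (fzero ∷ x) (fsuc fzero ∷ y)     ≡⟨ capCount-∷ s₁ s₂ _ _ x y ⟩
    capCount s₁ (suc s₂) x y
      + (capCount (suc s₁) s₂ x y + sum (map f (map fsuc (map fsuc (allFin q′)))))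
      ≡⟨ cong (λ z → capCount s₁ (suc s₂) x y + (capCount (suc s₁) s₂ x y + z))
              (trans (sum-map-map (map fsuc (allFin q′)))
                (trans (sum-map-map (allFin q′)) (sum-map-allFin-const q′ _ (λ _ → refl)))) ⟩
    capCount s₁ (suc s₂) x y + (capCount (suc s₁) s₂ x y + q′ * capCount (suc s₁) (suc s₂) x y)
      ≡⟨ +-assoc (capCount s₁ (suc s₂) x y) _ _ ⟨
    disagreeing (capCount s₁ (suc s₂) x y) (capCount (suc s₁) s₂ x y) (capCount (suc s₁) (suc s₂) x y) ∎
    where
    f : Fin q → ℕ
    f c = capCount (mismatch fzero c + s₁) (mismatch (fsuc fzero) c + s₂) x y

  capCount≡cap : ∀ j m s₁ s₂ → capCount s₁ s₂ (zeroWord q′ (j + m)) (onesWord q′ (j + m) j) ≡ cap s₁ s₂ j m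
  capCount≡cap (suc j) m s₁ s₂ = trans (capCount-disagreeing s₁ s₂ (zeroWord q′ (j + m)) (onesWord q′ (j + m) j))
    (cong₂ _+_ (cong₂ _+_ (capCount≡cap j m s₁ (suc s₂)) (capCount≡cap j m (suc s₁) s₂))
               (cong (q′ *_) (capCount≡cap j m (suc s₁) (suc s₂))))
  capCount≡cap zero (suc m) s₁ s₂ = trans (capCount-agreeing s₁ s₂ (zeroWord q′ m) (onesWord q′ m 0))
    (cong₂ agreeing (capCount≡cap zero m s₁ s₂) (capCount≡cap zero m (suc s₁) (suc s₂)))
  capCount≡cap zero zero s₁ s₂ rewrite +-identityʳ s₁ | +-identityʳ s₂ with s₁ ≤ᵇ t | s₂ ≤ᵇ t
  ... | true  | true  = refl
  ... | true  | false = refl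
  ... | false | true  = refl
  ... | false | false = refl

  W≡cap : ∀ {n} j m → j + m ≡ n → W q′ n t j ≡ cap 0 0 j m
  W≡cap j m refl = capCount≡cap j m 0 0

  W-antitone : ∀ {n} j → j < n → W q′ n t (suc j) ≤ W q′ n t j
  W-antitone j j<n with m , refl ← m≤n⇒∃[o]m+o≡n j<n =
    subst₂ _≤_ (sym (W≡cap (suc j) m refl)) (sym (W≡cap j (suc m) (+-suc j m))) (cap-disagreeing≤agreeing j m 0 0)

  W-two-step : ∀ {n} j → 1 ≤ t → 2 + j ≤ n → W q′ n t (2 + j) * (p * n) ≤ q * q * t * W q′ n t j
  W-two-step j 1≤t 2+j≤n with m , refl ← m≤n⇒∃[o]m+o≡n 2+j≤n = begin
    W q′ n t (2 + j) * r          ≡⟨ cong (_* r) (W≡cap (2 + j) m refl) ⟩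
    cap 0 0 (2 + j) m * r         ≤⟨ *-monoˡ-≤ r (cap-two-disagreeing≤ j m) ⟩
    q * q * x * r                 ≡⟨ trans (*-assoc (q * q) x r) (cong (q * q *_) (*-comm x r)) ⟩
    q * q * (r * x)               ≤⟨ *-monoʳ-≤ (q * q) (cap₁₁-shrink j m 1≤t) ⟩
    q * q * (t * cap 0 0 j (2 + m)) ≡⟨ *-assoc (q * q) t _ ⟨
    q * q * t * cap 0 0 j (2 + m)
      ≡⟨ cong (q * q * t *_) (W≡cap j (2 + m) (trans (+-suc j (suc m)) (cong suc (+-suc j m)))) ⟨
    q * q * t * W q′ n t j        ∎
    where
    n = 2 + j + m
    r = p * n
    x = cap 1 1 j m

  W-odd-bound : ∀ {n} k → 1 ≤ t → 2 * k + 2 ≤ n →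
    W q′ n t (2 * k + 1) * (p * n) ^ k ≤ 2 * (q * q * t) ^ k * W q′ n t 1
  W-odd-bound {n} k 1≤t 2k+2≤n =
    ≤-trans (iterate-≤ (λ i → W q′ n t (2 * i + 1)) (q * q * t) (p * n) k step)
            (*-monoˡ-≤ (W q′ n t 1) (m≤m+n ((q * q * t) ^ k) (1 * (q * q * t) ^ k)))
    where
    index : ∀ i → 2 * suc i + 1 ≡ 2 + (2 * i + 1)
    index = solve-∀
    step : ∀ i → i < k → W q′ n t (2 * suc i + 1) * (p * n) ≤ q * q * t * W q′ n t (2 * i + 1)
    step i i<k = subst (λ l → W q′ n t l * (p * n) ≤ q * q * t * W q′ n t (2 * i + 1)) (sym (index i))
      (W-two-step (2 * i + 1) 1≤t
        (subst (_≤ n) (index i) (≤-trans (+-mono-≤ (*-monoʳ-≤ 2 i<k) (s≤s z≤n)) 2k+2≤n)))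

  W₁-bound : ∀ m → W q′ (suc m) t 1 * (p * suc m) ≤ q * q * t * V q (suc m) t
  W₁-bound m = begin
    W q′ (suc m) t 1 * r              ≡⟨ cong (_* r) (capCount≡cap 1 m 0 0) ⟩
    cap 0 0 1 m * r
      ≤⟨ *-monoˡ-≤ r (disagreeing-mono-≤ y₀₁≤y (subst (_≤ y) (cap-comm 0 m 0 1) y₀₁≤y) ≤-refl) ⟩
    disagreeing y y y * r             ≡⟨ cong (_* r) (disagreeing-diag y) ⟩
    q * y * r                         ≡⟨ trans (*-assoc q y r) (cong (q *_) (*-comm y r)) ⟩
    q * (r * y)                       ≤⟨ *-monoʳ-≤ q (cap-shrink 0 m t 0 0 (m≤m+n t 0)) ⟩
    q * (t * cap 0 0 0 (suc m))       ≡⟨ cong (λ v → q * (t * v)) (cap-ball (suc m) t 0 refl) ⟩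
    q * (t * V q (suc m) t)           ≤⟨ *-monoʳ-≤ q (m≤n*m (t * V q (suc m) t) q) ⟩
    q * (q * (t * V q (suc m) t))
      ≡⟨ trans (*-assoc (q * q) t (V q (suc m) t)) (*-assoc q q (t * V q (suc m) t)) ⟨
    q * q * t * V q (suc m) t         ∎
    where
    r = p * suc m
    y = cap 1 1 0 m
    y₀₁≤y : cap 0 1 0 m ≤ y
    y₀₁≤y = cap₀-raiseˡ m 0 1 (s≤s z≤n)

lemma3p5 : (q' n t : ℕ) → let q = 2 + q' in
    1 ≤ n → 1 ≤ t → t * t ≤ 100 * n →
    (k : ℕ) → 2 * k + 2 ≤ n →
      (W q' n t (2 * k + 2) ≤ W q' n t (2 * k + 1))
      × (W q' n t (2 * k + 1) * ((q ∸ 1) * n) ^ k ≤ 2 * (q * q * t) ^ k * W q' n t 1)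
      × (2 * (q * q * t) ^ k * W q' n t 1 * ((q ∸ 1) * n) ^ (k + 1)
           ≤ 2 * (q * q * t) ^ (k + 1) * V q n t * ((q ∸ 1) * n) ^ k)
lemma3p5 q′ n@(suc m) t _ 1≤t _ k 2k+2≤n =
    subst (λ i → W q′ n t i ≤ W q′ n t (2 * k + 1)) (sym 2k+2≡)
      (W-antitone q′ t (2 * k + 1) (subst (_≤ n) 2k+2≡ 2k+2≤n))
  , W-odd-bound q′ t k 1≤t 2k+2≤n
  , cross-mul-pow-≤ ((2 + q′) * (2 + q′) * t) (suc q′ * n) 2 k (W₁-bound q′ t m)
  where
  2k+2≡ : 2 * k + 2 ≡ suc (2 * k + 1)
  2k+2≡ = +-suc (2 * k) 1
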